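{- Let $G$ be a finite simple graph, $X$ a solution, $v\in AWS(X)$ such that $X\cup\{v\}$ is a solution, $u\in N^2(v)\cap AWS(X)$, and $Z=X\cup\{u,v\}$. Then $u\in\mathrm{Del}_{AWS}(X,v)$ if and only if there exist $w_1,w_2\in N_Z(u)$ with $N_{X\cup\{u\}}(w_1)\subsetneq N_{X\cup\{u\}}(w_2)$, $v\in N_Z(w_1)$ and $v\notin N_Z(w_2)$.
   Context: For $S\subseteq V$, $N_S(u)=N(u)\cap S$; $N^2(v)$ is the set of vertices at distance exactly $2$ from $v$ in $G$. In $G[S]$, $a,b$ are comparable if $N_S(a)\subseteq N_S(b)$ or $N_S(b)\subseteq N_S(a)$; $u\in S$ is weak-simplicial in $G[S]$ if $N_S(u)$ is independent and any two vertices of $N_S(u)$ are comparable in $G[S]$. A solution is $X\subseteq V$ with $G[X]$ chordal bipartite (bipartite, no induced cycle of length $\ge6$). $WS(S)$ is the set of weak-simplicial vertices of $G[S]$. $AWS(X)=\{u\in V\setminus X: u\in WS(X\cup\{u\})\}$. $N^{1:2}(v)$ is the set of vertices at distance $1$ or $2$ from $v$ in $G$. $\mathrm{Del}_{AWS}(X,v)=\{u\in N^{1:2}(v)\cap AWS(X): u\notin WS(X\cup\{u,v\})\}$. -}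

module Defs where

open import Data.Nat using (ℕ; _≤_)
open import Data.Fin using (Fin; zero; suc; toℕ)
open import Data.Fin.Subset using (Subset; _∈_; _∉_; _∪_; ⁅_⁆)
open import Data.Product using (Σ; ∃; _×_; _,_)
open import Data.Sum using (_⊎_)
open import Relation.Nullary using (¬_; Dec)
open import Relation.Binary.PropositionalEquality using (_≡_)
open import Function.Definitions using (Injective)

record Graph : Set₁ where
  field
    n     : ℕ
    _~_   : Fin n → Fin n → Set
    sym   : ∀ {a b} → a ~ b → b ~ a
    irr   : ∀ {a} → ¬ (a ~ a)
    dec   : ∀ a b → Dec (a ~ b)

module _ (G : Graph) where
  open Graph G

  V : Set
  V = Fin n

  VPred : Set₁
  VPred = V → Set

  _⊆ₚ_ : VPred → VPred → Set
  A ⊆ₚ B = ∀ x → A x → B x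

  _⊊ₚ_ : VPred → VPred → Set
  A ⊊ₚ B = A ⊆ₚ B × ¬ (B ⊆ₚ A)

  NS : Subset n → V → VPred
  NS S u w = w ∈ S × u ~ w

  N2 : V → VPred
  N2 v u = ¬ (u ≡ v) × ¬ (u ~ v) × ∃ λ w → (u ~ w) × (w ~ v)

  N12 : V → VPred
  N12 v u = (u ~ v) ⊎ N2 v u

  Independent : VPred → Set
  Independent I = ∀ a b → I a → I b → ¬ (a ~ b)

  Comparable : Subset n → V → V → Set
  Comparable S a b = (NS S a ⊆ₚ NS S b) ⊎ (NS S b ⊆ₚ NS S a)

  WS : Subset n → VPred
  WS S u = u ∈ S × Independent (NS S u)
           × (∀ a b → NS S u a → NS S u b → Comparable S a b)

  Bipartite : Subset n → Set
  Bipartite X = Σ (V → Fin 2) λ c →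
    ∀ a b → a ∈ X → b ∈ X → a ~ b → ¬ (c a ≡ c b)

  CycAdj : {k : ℕ} → Fin k → Fin k → Set
  CycAdj {k} i j = (toℕ j ≡ Data.Nat._+_ (toℕ i) 1) ⊎ (toℕ i ≡ Data.Nat._+_ (toℕ j) 1)
                   ⊎ ((toℕ i ≡ 0) × (Data.Nat._+_ (toℕ j) 1 ≡ k))
                   ⊎ ((toℕ j ≡ 0) × (Data.Nat._+_ (toℕ i) 1 ≡ k))

  InducedCycle : Subset n → ℕ → Set
  InducedCycle X k = Σ (Fin k → V) λ f →
    Injective _≡_ _≡_ f × (∀ i → f i ∈ X)
    × (∀ i j → (f i ~ f j → CycAdj i j) × (CycAdj i j → f i ~ f j))

  -- X is a solution: G[X] is chordal bipartite
  Solution : Subset n → Set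
  Solution X = Bipartite X × (∀ k → 6 ≤ k → ¬ InducedCycle X k)

  AWS : Subset n → VPred
  AWS X u = u ∉ X × WS (X ∪ ⁅ u ⁆) u

  DelAWS : Subset n → V → VPred
  DelAWS X v u = N12 v u × AWS X u × ¬ WS (X ∪ ⁅ u ⁆ ∪ ⁅ v ⁆) u

module Submission where

open import Defs
open import Data.Nat using (ℕ)
open import Data.Fin using (Fin)
open import Function using (_∘_)
open import Data.Fin.Subset using (Subset; _∈_; _⊆_; _∪_; ⁅_⁆)
open import Data.Fin.Subset.Properties using (_∈?_; x∈p∪q⁻; p⊆p∪q; q⊆p∪q; x∈⁅x⁆; x∈⁅y⁆⇒x≡y)
open import Data.Fin.Properties using (any?; all?)
open import Data.Product using (∃₂; _×_; _,_; proj₂)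
open import Data.Sum using (_⊎_; inj₁; inj₂; swap)
open import Function.Bundles using (_⇔_; mk⇔)
open import Relation.Nullary using (¬_; Dec; yes; no; contradiction)
open import Relation.Nullary.Decidable using (_×-dec_; ¬?; _→-dec_; decidable-stable)
open import Relation.Binary.PropositionalEquality using (_≡_; refl)

-- Since u ∈ N²(v), adding v to X ∪ {u} leaves N(u) unchanged and its
-- independence intact, and can only break comparability of two neighbours w₁, w₂ of u:
-- the comparable pair with N(w₁) ⊆ N(w₂) stays comparable unless v is added to N(w₁)
-- but not to N(w₂) and the inclusion was strict.

module _ (G : Graph) where
  open Graph G

  private
    infix 4 _⊆ₙ_ _⊊ₙ_
    _⊆ₙ_ _⊊ₙ_ : VPred G → VPred G → Set
    _⊆ₙ_ = _⊆ₚ_ G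
    _⊊ₙ_ = _⊊ₚ_ G

  NS? : (S : Subset n) (a x : V G) → Dec (NS G S a x)
  NS? S a x = (x ∈? S) ×-dec dec a x

  NS-⊆? : (S : Subset n) (a b : V G) → Dec (NS G S a ⊆ₙ NS G S b)
  NS-⊆? S a b = all? λ x → NS? S a x →-dec NS? S b x

  Obstruction : Subset n → Subset n → V G → V G → Set
  Obstruction Y Z u v = ∃₂ λ w₁ w₂ → NS G Z u w₁ × NS G Z u w₂
    × NS G Y w₁ ⊊ₙ NS G Y w₂ × NS G Z w₁ v × ¬ NS G Z w₂ v

  Obstruction? : ∀ Y Z u v → Dec (Obstruction Y Z u v)
  Obstruction? Y Z u v = any? λ w₁ → any? λ w₂ →
    NS? Z u w₁ ×-dec NS? Z u w₂
    ×-dec (NS-⊆? Y w₁ w₂ ×-dec ¬? (NS-⊆? Y w₂ w₁))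
    ×-dec NS? Z w₁ v ×-dec ¬? (NS? Z w₂ v)

  module OneVertexExtension {Y Z : Subset n} {v : V G}
           (Y⊆Z : Y ⊆ Z) (v∈Z : v ∈ Z) (Z⊆Y+v : ∀ {x} → x ∈ Z → x ∈ Y ⊎ x ≡ v) where

    NS-⊆-extend : ∀ {a b} → NS G Y a ⊆ₙ NS G Y b → (a ~ v → b ~ v) → NS G Z a ⊆ₙ NS G Z b
    NS-⊆-extend Na⊆Nb a~v⇒b~v x (x∈Z , a~x) with Z⊆Y+v x∈Z
    ... | inj₁ x∈Y = x∈Z , proj₂ (Na⊆Nb x (x∈Y , a~x))
    ... | inj₂ refl = x∈Z , a~v⇒b~v a~x

    NS-⊆-restrict : ∀ {a b} → NS G Z a ⊆ₙ NS G Z b → NS G Y a ⊆ₙ NS G Y b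
    NS-⊆-restrict Na⊆Nb x (x∈Y , a~x) = x∈Y , proj₂ (Na⊆Nb x (Y⊆Z x∈Y , a~x))

    NS-nonadjacent : ∀ {u} → ¬ u ~ v → NS G Z u ⊆ₙ NS G Y u
    NS-nonadjacent u≁v x (x∈Z , u~x) with Z⊆Y+v x∈Z
    ... | inj₁ x∈Y = x∈Y , u~x
    ... | inj₂ refl = contradiction u~x u≁v

    comparable-extend : ∀ {u a b} → ¬ Obstruction Y Z u v → NS G Z u a → NS G Z u b →
                        NS G Y a ⊆ₙ NS G Y b → Comparable G Z a b
    comparable-extend {a = a} {b} no-obstruction ua ub Na⊆Nb with dec a v | dec b v
    ... | no a≁v | _ = inj₁ (NS-⊆-extend Na⊆Nb λ a~v → contradiction a~v a≁v)
    ... | yes _ | yes b~v = inj₁ (NS-⊆-extend Na⊆Nb λ _ → b~v)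
    ... | yes a~v | no b≁v with NS-⊆? Y b a
    ...   | yes Nb⊆Na = inj₂ (NS-⊆-extend Nb⊆Na λ b~v → contradiction b~v b≁v)
    ...   | no Nb⊈Na =
      contradiction (a , b , ua , ub , (Na⊆Nb , Nb⊈Na) , (v∈Z , a~v) , b≁v ∘ proj₂) no-obstruction

    WS-extend : ∀ {u} → ¬ u ~ v → WS G Y u → ¬ Obstruction Y Z u v → WS G Z u
    WS-extend {u} u≁v (u∈Y , independent , comparable) no-obstruction =
      Y⊆Z u∈Y , independentᶻ , comparableᶻ
      where
      Nu⊆ : NS G Z u ⊆ₙ NS G Y u
      Nu⊆ = NS-nonadjacent u≁v

      independentᶻ : Independent G (NS G Z u)
      independentᶻ a b ua ub = independent a b (Nu⊆ a ua) (Nu⊆ b ub)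

      comparableᶻ : ∀ a b → NS G Z u a → NS G Z u b → Comparable G Z a b
      comparableᶻ a b ua ub with comparable a b (Nu⊆ a ua) (Nu⊆ b ub)
      ... | inj₁ Na⊆Nb = comparable-extend no-obstruction ua ub Na⊆Nb
      ... | inj₂ Nb⊆Na = swap (comparable-extend no-obstruction ub ua Nb⊆Na)

    Obstruction⇒¬WS : ∀ {u} → Obstruction Y Z u v → ¬ WS G Z u
    Obstruction⇒¬WS (w₁ , w₂ , uw₁ , uw₂ , (_ , N₂⊈N₁) , w₁v , ¬w₂v) (_ , _ , comparable)
      with comparable w₁ w₂ uw₁ uw₂
    ... | inj₁ N₁⊆N₂ = ¬w₂v (N₁⊆N₂ v w₁v)
    ... | inj₂ N₂⊆N₁ = N₂⊈N₁ (NS-⊆-restrict N₂⊆N₁)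

    ¬WS⇒Obstruction : ∀ {u} → ¬ u ~ v → WS G Y u → ¬ WS G Z u → Obstruction Y Z u v
    ¬WS⇒Obstruction {u} u≁v u∈WS u∉WS =
      decidable-stable (Obstruction? Y Z u v) (u∉WS ∘ WS-extend u≁v u∈WS)

module _ {n : ℕ} (X : Subset n) (u v : Fin n) where

  X∪u⊆X∪u∪v : X ∪ ⁅ u ⁆ ⊆ X ∪ ⁅ u ⁆ ∪ ⁅ v ⁆
  X∪u⊆X∪u∪v x∈ with x∈p∪q⁻ X ⁅ u ⁆ x∈
  ... | inj₁ x∈X = p⊆p∪q _ x∈X
  ... | inj₂ x∈u = q⊆p∪q X _ (p⊆p∪q ⁅ v ⁆ x∈u)

  v∈X∪u∪v : v ∈ X ∪ ⁅ u ⁆ ∪ ⁅ v ⁆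
  v∈X∪u∪v = q⊆p∪q X _ (q⊆p∪q ⁅ u ⁆ _ (x∈⁅x⁆ v))

  X∪u∪v⊆X∪u+v : ∀ {x} → x ∈ X ∪ ⁅ u ⁆ ∪ ⁅ v ⁆ → x ∈ X ∪ ⁅ u ⁆ ⊎ x ≡ v
  X∪u∪v⊆X∪u+v x∈ with x∈p∪q⁻ X _ x∈
  ... | inj₁ x∈X = inj₁ (p⊆p∪q _ x∈X)
  ... | inj₂ x∈u∪v with x∈p∪q⁻ ⁅ u ⁆ ⁅ v ⁆ x∈u∪v
  ...   | inj₁ x∈u = inj₁ (q⊆p∪q X _ x∈u)
  ...   | inj₂ x∈v = inj₂ (x∈⁅y⁆⇒x≡y v x∈v)

lemma12 : (G : Graph) (X : Subset (Graph.n G)) (v u : V G)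
    → Solution G X
    → AWS G X v
    → Solution G (X ∪ ⁅ v ⁆)
    → N2 G v u
    → AWS G X u
    → DelAWS G X v u
      ⇔ (∃₂ λ w₁ w₂ → NS G (X ∪ ⁅ u ⁆ ∪ ⁅ v ⁆) u w₁ × NS G (X ∪ ⁅ u ⁆ ∪ ⁅ v ⁆) u w₂
           × _⊊ₚ_ G (NS G (X ∪ ⁅ u ⁆) w₁) (NS G (X ∪ ⁅ u ⁆) w₂)
           × NS G (X ∪ ⁅ u ⁆ ∪ ⁅ v ⁆) w₁ v
           × ¬ NS G (X ∪ ⁅ u ⁆ ∪ ⁅ v ⁆) w₂ v)
lemma12 G X v u _ _ _ u∈N²v@(_ , u≁v , _) u∈AWS@(_ , u∈WS) =
  mk⇔ (λ (_ , _ , u∉WS) → ¬WS⇒Obstruction u≁v u∈WS u∉WS)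
      (λ obstruction → inj₂ u∈N²v , u∈AWS , Obstruction⇒¬WS obstruction)
  where
  open OneVertexExtension G (X∪u⊆X∪u∪v X u v) (v∈X∪u∪v X u v) (X∪u∪v⊆X∪u+v X u v)
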